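{- Let $\phi$ be a formula as described in the context, with $n$ variables and $m$ clauses, and let $G$ be the weighted graph constructed from $\phi$. If there is a truth assignment that satisfies at least $k$ clauses of $\phi$, then $G$ has a greedy matching of weight at least $14n+k$.
   Context: Greedy matching: for a finite simple undirected graph with positive edge weights and distinct weights $w_1>\dots>w_\ell$, a greedy matching is any matching that can be output by: $\mathcal{M}\leftarrow\emptyset$; for $i=1,\dots,\ell$, while the current edge set contains an edge of weight $w_i$, pick any such edge $e^*$, add it to $\mathcal{M}$, and delete all edges sharing an endpoint with $e^*$. The weight of a matching is the sum of its edge weights. Formula: $\phi$ is a CNF formula over variables $x_1,\dots,x_n$ with clauses $C_1,\dots,C_m$ (in this fixed order), each clause having at most 2 literals, and each variable $x_i$ occurring either exactly twice in $\phi$ (once as $x_i$, once as $\overline{x_i}$) or exactly three times (once as $x_i$, twice as $\overline{x_i}$). Construction of $G$: for each variable $x_i$ take a path on the ten vertices $\beta_{x_i},p_{x_i},q_{x_i},r_{x_i},\alpha_{x_i},\gamma_{x_i},y_{x_i},z_{x_i},s_{x_i},t_{x_i}$ (in this order) with consecutive edge weights $1,3,4,4,4,4,4,3,1$, i.e. $w(\beta,p)=1$, $w(p,q)=3$, $w(q,r)=w(r,\alpha)=w(\alpha,\gamma)=w(\gamma,y)=w(y,z)=4$, $w(z,s)=3$, $w(s,t)=1$. For each clause $C_j$ add a vertex $v_j$. If $x_i$ occurs positively in $C_j$, add edge $(v_j,\alpha_{x_i})$ of weight 3; if $C_j$ is the first clause (in the fixed order) in which $\overline{x_i}$ occurs,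 add edge $(v_j,\beta_{x_i})$ of weight 1; if $C_j$ is the second clause in which $\overline{x_i}$ occurs, add edge $(v_j,\gamma_{x_i})$ of weight 3. There are no other edges. -}

module Defs where

open import Data.Nat using (ℕ; zero; suc; _+_; _*_; _≤_; _<_; _>_; _<?_)
open import Data.Nat.Properties using () renaming (_≟_ to _≟ℕ_)
open import Data.Fin using (Fin; toℕ) renaming (_≟_ to _≟F_)
open import Data.Fin.Patterns
open import Data.Bool using (Bool; true; false) renaming (_≟_ to _≟B_)
open import Data.List using (List; []; _∷_; _++_; length; filter; concatMap; map; allFin)
open import Data.Nat.ListAction using (sum)
open import Data.List.Relation.Unary.Any using (Any)
open import Data.List.Relation.Unary.Any using (any?)
open import Data.List.Relation.Unary.Linked using (Linked)
open import Data.List.Membership.Propositional using (_∈_)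
open import Data.Vec using (Vec; lookup)
open import Data.Product using (Σ; ∃; _×_; _,_)
open import Data.Product.Properties using (≡-dec)
open import Data.Sum using (_⊎_)
open import Relation.Nullary using (¬_; Dec; yes; no; ¬?)
open import Relation.Nullary.Decidable using (_×-dec_; _⊎-dec_)
open import Relation.Binary.PropositionalEquality using (_≡_; refl; cong; cong₂)
open import Relation.Binary using (DecidableEquality)
open import Function.Bundles using (_⇔_)

record WEdge (V : Set) : Set where
  constructor wedge
  field
    u v : V
    w   : ℕ
open WEdge public

module _ {V : Set} (_≟V_ : DecidableEquality V) where

  Shares : WEdge V → WEdge V → Set
  Shares e f = (u e ≡ u f ⊎ u e ≡ v f) ⊎ (v e ≡ u f ⊎ v e ≡ v f)

  shares? : (e f : WEdge V) → Dec (Shares e f)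
  shares? e f = ((u e ≟V u f) ⊎-dec (u e ≟V v f)) ⊎-dec ((v e ≟V u f) ⊎-dec (v e ≟V v f))

  removeAdj : WEdge V → List (WEdge V) → List (WEdge V)
  removeAdj e E = filter (λ f → ¬? (shares? e f)) E

  HasWeight : ℕ → List (WEdge V) → Set
  HasWeight x E = Any (λ f → w f ≡ x) E

  -- inner "while" loop for the weight x:
  -- Phase x E M E' M'  : starting from current edge set E and matching M,
  -- the loop can terminate with edge set E' and matching M'.
  data Phase (x : ℕ) : List (WEdge V) → List (WEdge V) →
                       List (WEdge V) → List (WEdge V) → Set where
    stop : ∀ {E M} → ¬ HasWeight x E → Phase x E M E M
    pick : ∀ {E M E' M'} (e : WEdge V) → e ∈ E → w e ≡ x →
           Phase x (removeAdj e E) (e ∷ M) E' M' → Phase x E M E' M'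

  -- outer "for" loop over the list of weights w₁ > … > w_ℓ
  data Run : List ℕ → List (WEdge V) → List (WEdge V) → List (WEdge V) → Set where
    done : ∀ {E M} → Run [] E M M
    next : ∀ {x xs E M E' M' M''} → Phase x E M E' M' → Run xs E' M' M'' →
           Run (x ∷ xs) E M M''

  IsGreedyMatching : List (WEdge V) → List (WEdge V) → Set
  IsGreedyMatching E M =
    Σ (List ℕ) λ ws →
      Linked _>_ ws ×
      (∀ x → (x ∈ ws) ⇔ HasWeight x E) ×
      Run ws E [] M

weight : {V : Set} → List (WEdge V) → ℕ
weight M = sum (map w M)

-- a literal (i , true) is x_i, (i , false) is the negation of x_i
Lit : ℕ → Set
Lit n = Fin n × Bool

_≟L_ : ∀ {n} → DecidableEquality (Lit n)
_≟L_ = ≡-dec _≟F_ _≟B_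

Clause : ℕ → Set
Clause n = List (Lit n)

Formula : ℕ → ℕ → Set
Formula n m = Vec (Clause n) m

_∈L?_ : ∀ {n} (l : Lit n) (c : Clause n) → Dec (l ∈ c)
l ∈L? c = any? (λ l' → l ≟L l') c

occ : ∀ {n m} → Formula n m → Lit n → ℕ
occ {m = m} φ l = sum (map (λ j → length (filter (λ l' → l ≟L l') (lookup φ j))) (allFin m))

WellFormed : ∀ {n m} → Formula n m → Set
WellFormed {n} {m} φ =
  (∀ (j : Fin m) → length (lookup φ j) ≤ 2) ×
  (∀ (i : Fin n) → occ φ (i , true) ≡ 1 × (occ φ (i , false) ≡ 1 ⊎ occ φ (i , false) ≡ 2))

negBefore : ∀ {n m} → Formula n m → Fin n → Fin m → ℕ
negBefore {m = m} φ i j =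
  length (filter (λ j' → (toℕ j' <? toℕ j) ×-dec ((i , false) ∈L? lookup φ j')) (allFin m))

data Vtx (n m : ℕ) : Set where
  gad : Fin n → Fin 10 → Vtx n m   -- vertex number k of the path of x_i
  cls : Fin m → Vtx n m

_≟V_ : ∀ {n m} → DecidableEquality (Vtx n m)
gad i a ≟V gad i' a' with i ≟F i' | a ≟F a'
... | yes refl | yes refl = yes refl
... | no ne | _ = no λ { refl → ne refl }
... | yes _ | no ne = no λ { refl → ne refl }
gad _ _ ≟V cls _ = no λ ()
cls _ ≟V gad _ _ = no λ ()
cls j ≟V cls j' with j ≟F j'
... | yes refl = yes refl
... | no ne = no λ { refl → ne refl }

β p q r α γ y z s t : Fin 10
β = 0F ; p = 1F ; q = 2F ; r = 3F ; α = 4F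
γ = 5F ; y = 6F ; z = 7F ; s = 8F ; t = 9F

pathEdges : ∀ {n m} → Fin n → List (WEdge (Vtx n m))
pathEdges i =
  wedge (gad i β) (gad i p) 1 ∷ wedge (gad i p) (gad i q) 3 ∷
  wedge (gad i q) (gad i r) 4 ∷ wedge (gad i r) (gad i α) 4 ∷
  wedge (gad i α) (gad i γ) 4 ∷ wedge (gad i γ) (gad i y) 4 ∷
  wedge (gad i y) (gad i z) 4 ∷ wedge (gad i z) (gad i s) 3 ∷
  wedge (gad i s) (gad i t) 1 ∷ []

posE : ∀ {n m} (i : Fin n) (j : Fin m) {P : Set} → Dec P → List (WEdge (Vtx n m))
posE i j (yes _) = wedge (cls j) (gad i α) 3 ∷ []
posE i j (no _)  = []

negE : ∀ {n m} (i : Fin n) (j : Fin m) {P : Set} → Dec P → ℕ → List (WEdge (Vtx n m))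
negE i j (yes _) zero          = wedge (cls j) (gad i β) 1 ∷ []
negE i j (yes _) (suc zero)    = wedge (cls j) (gad i γ) 3 ∷ []
negE i j (yes _) (suc (suc _)) = []
negE i j (no _)  _             = []

clauseEdges : ∀ {n m} → Formula n m → Fin n → Fin m → List (WEdge (Vtx n m))
clauseEdges φ i j =
  posE i j ((i , true) ∈L? lookup φ j) ++
  negE i j ((i , false) ∈L? lookup φ j) (negBefore φ i j)

graphG : ∀ {n m} → Formula n m → List (WEdge (Vtx n m))
graphG {n} {m} φ =
  concatMap pathEdges (allFin n) ++
  concatMap (λ j → concatMap (λ i → clauseEdges φ i j) (allFin n)) (allFin m)

Assignment : ℕ → Set
Assignment n = Fin n → Bool

satisfies? : ∀ {n} (a : Assignment n) (c : Clause n) → Dec (Any (λ l → a (Data.Product.proj₁ l) ≡ Data.Product.proj₂ l) c)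
satisfies? a c = any? (λ l → a (Data.Product.proj₁ l) ≟B Data.Product.proj₂ l) c

numSat : ∀ {n m} → Formula n m → Assignment n → ℕ
numSat {m = m} φ a = length (filter (λ j → satisfies? a (lookup φ j)) (allFin m))

module Submission where

-- Credit each satisfied clause to the variable of its first true literal. For every
-- variable x_i we fix a plan: the edges of weight 4, 3 and 1 to choose, in that order,
-- inside its gadget (its path and the clause vertices credited to x_i). A plan weighs
-- 14 plus a bonus of one per credited clause; as ¬x_i occurs at most twice, the credits
-- never exceed the bonus. Running all plans together, phase by phase, is a greedy run:
-- the planned edges form a matching (gadgets own disjoint vertex sets), the heavy edges
-- meet every edge of weight 4 and heavy and middle edges meet every edge of weight 3, so
-- these phases stop right after their planned edges; the last phase is finished greedily.
-- The local properties of a plan are finite checks, settled by evaluating decision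
-- procedures in local coordinates of the gadget.

open import Defs
open import Data.Nat using (ℕ; zero; suc; _+_; _*_; _≤_; _<_; z≤n; s≤s; _≟_; _<?_)
open import Data.Nat.Properties
  using (≤-refl; ≤-reflexive; ≤-trans; ≤-pred; m≤m+n; m≤n+m; m≤n⇒m≤1+n; n<1+n; <-trans; <-irrefl; <-cmp;
         +-mono-≤; +-mono-≤-<; +-monoʳ-≤; +-assoc; +-comm; *-zeroʳ; *-suc; +-commutativeSemigroup; module ≤-Reasoning)
open import Data.Nat.ListAction using (sum)
open import Data.Nat.ListAction.Properties using (sum-++)
open import Data.Nat.Tactic.RingSolver using (solve-∀)
open import Algebra.Properties.CommutativeSemigroup +-commutativeSemigroup using (interchange)
open import Data.Fin using (Fin; toℕ; inject₁) renaming (_≟_ to _≟F_)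
open import Data.Fin.Patterns
import Data.Fin.Properties as Fin
open import Data.List using (List; []; _∷_; _++_; length; filter; map; concatMap; allFin; _ʳ++_)
open import Data.List.Properties
  using (filter-none; filter-accept; filter-reject; filter-some; filter-notAll; map-++; map-cong; length-tabulate)
open import Data.List.Relation.Unary.Any as Any using (Any; here; there)
import Data.List.Relation.Unary.Any.Properties as AnyP
open import Data.List.Relation.Unary.All as All using (All; []; _∷_)
import Data.List.Relation.Unary.All.Properties as AllP
import Data.List.Relation.Unary.All.Properties.Core as AllPC
open import Data.List.Relation.Unary.AllPairs as AllPairs using (AllPairs; []; _∷_; allPairs?)
import Data.List.Relation.Unary.AllPairs.Properties as AllPairsP
open import Data.List.Relation.Unary.Linked using ([]; [-]; _∷_)
open import Data.List.Relation.Unary.Unique.Propositional using (Unique)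
open import Data.List.Relation.Unary.Unique.Propositional.Properties using (allFin⁺)
open import Data.List.Membership.Propositional using (_∈_; find; lose)
open import Data.List.Membership.Propositional.Properties
  using (∈-filter⁺; ∈-filter⁻; ∈-++⁺ˡ; ∈-++⁺ʳ; ∈-++⁻; ∈-concatMap⁺; ∈-concatMap⁻; ∈-map⁺; ∈-map⁻; ∈-allFin)
open import Data.List.Membership.DecPropositional _≟_ using (_∈?_)
open import Data.Maybe using (Maybe; just; nothing)
open import Data.Maybe.Properties using (just-injective) renaming (≡-dec to ≡-decMaybe)
open import Data.Vec using (lookup)
open import Data.Product using (Σ; ∃; _×_; _,_; proj₁; proj₂)
open import Data.Sum using (_⊎_; inj₁; inj₂; [_,_])
open import Data.Bool using (true; false)
open import Data.Empty using (⊥-elim)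
open import Function using (_∘_; id)
open import Function.Bundles using (_⇔_; mk⇔)
open import Relation.Nullary using (¬_; Dec; yes; no; ¬?; contradiction)
open import Relation.Nullary.Decidable using (True; toWitness; map′; _×-dec_; _⊎-dec_; _→-dec_)
open import Relation.Unary using (Decidable; ∁)
open import Relation.Binary using (DecidableEquality; tri<; tri≈; tri>)
open import Relation.Binary.PropositionalEquality using (_≡_; refl; sym; trans; cong; cong₂; subst; module ≡-Reasoning)

count : {A : Set} {P : A → Set} → Decidable P → List A → ℕ
count P? xs = length (filter P? xs)

count-∷ : {A : Set} {P : A → Set} (P? : Decidable P) → ∀ x xs →
          count P? (x ∷ xs) ≡ count P? (x ∷ []) + count P? xs
count-∷ P? x xs with P? x
... | yes _ = refl
... | no  _ = refl

module _ {A : Set} {P : A → Set} (P? : Decidable P) where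

  count-none : ∀ {xs} → All (∁ P) xs → count P? xs ≡ 0
  count-none none = cong length (filter-none P? none)

  count-≤1 : (∀ {x y} → P x → P y → x ≡ y) → ∀ {xs} → Unique xs → count P? xs ≤ 1
  count-≤1 same {[]}     _           = z≤n
  count-≤1 same {x ∷ xs} (x∉ ∷ uniq) with P? x
  ... | yes px = s≤s (≤-reflexive (count-none (All.map (λ x≢y py → x≢y (same px py)) x∉)))
  ... | no  _  = count-≤1 same uniq

  count-≤-sum : (f : A → ℕ) → (∀ {x} → P x → 1 ≤ f x) → ∀ xs → count P? xs ≤ sum (map f xs)
  count-≤-sum f pos []       = z≤n
  count-≤-sum f pos (x ∷ xs) with P? x
  ... | yes px = +-mono-≤ (pos px) (count-≤-sum f pos xs)
  ... | no  _  = ≤-trans (count-≤-sum f pos xs) (m≤n+m _ _)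

  module _ {Q : A → Set} (Q? : Decidable Q) where

    count-mono : (∀ {x} → P x → Q x) → ∀ xs → count P? xs ≤ count Q? xs
    count-mono P⇒Q []       = z≤n
    count-mono P⇒Q (x ∷ xs) with P? x | Q? x
    ... | yes _  | yes _  = s≤s (count-mono P⇒Q xs)
    ... | yes px | no ¬qx = ⊥-elim (¬qx (P⇒Q px))
    ... | no _   | yes _  = m≤n⇒m≤1+n (count-mono P⇒Q xs)
    ... | no _   | no _   = count-mono P⇒Q xs

    count-strict : (∀ {x} → P x → Q x) → ∀ {y xs} → y ∈ xs → Q y → ¬ P y →
                   count P? xs < count Q? xs
    count-strict P⇒Q {xs = _ ∷ xs} (here refl) qy ¬py
      rewrite filter-reject P? {xs = xs} ¬py | filter-accept Q? {xs = xs} qy = s≤s (count-mono P⇒Q xs)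
    count-strict P⇒Q {xs = x ∷ xs} (there y∈) qy ¬py
      rewrite count-∷ P? x xs | count-∷ Q? x xs =
      +-mono-≤-< (count-mono P⇒Q (x ∷ [])) (count-strict P⇒Q y∈ qy ¬py)

sum-map-+ : {B : Set} (f g : B → ℕ) (bs : List B) →
            sum (map (λ b → f b + g b) bs) ≡ sum (map f bs) + sum (map g bs)
sum-map-+ f g []       = refl
sum-map-+ f g (b ∷ bs) = trans (cong (f b + g b +_) (sum-map-+ f g bs)) (interchange (f b) (g b) _ _)

sum-map-mono : {B : Set} {f g : B → ℕ} → (∀ b → f b ≤ g b) → ∀ bs → sum (map f bs) ≤ sum (map g bs)
sum-map-mono f≤g []       = z≤n
sum-map-mono f≤g (b ∷ bs) = +-mono-≤ (f≤g b) (sum-map-mono f≤g bs)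

sum-const : {B : Set} (c : ℕ) (bs : List B) → sum (map (λ _ → c) bs) ≡ c * length bs
sum-const c []       = sym (*-zeroʳ c)
sum-const c (b ∷ bs) = trans (cong (c +_) (sum-const c bs)) (sym (*-suc c (length bs)))

elem≤sum : {B : Set} (f : B → ℕ) {b : B} {bs : List B} → b ∈ bs → f b ≤ sum (map f bs)
elem≤sum f (here refl) = m≤m+n _ _
elem≤sum f (there b∈)  = ≤-trans (elem≤sum f b∈) (m≤n+m _ _)

module _ {A B : Set} {P : A → Set} (P? : Decidable P) {Q : B → A → Set} (Q? : ∀ b → Decidable (Q b)) where

  count-cover : (bs : List B) → (∀ {x} → P x → ∃ λ b → b ∈ bs × Q b x) → ∀ xs →
                count P? xs ≤ sum (map (λ b → count (Q? b) xs) bs)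
  count-cover bs cover []       = z≤n
  count-cover bs cover (x ∷ xs) = begin
    count P? (x ∷ xs)                                        ≡⟨ count-∷ P? x xs ⟩
    count P? (x ∷ []) + count P? xs                          ≤⟨ +-mono-≤ first (count-cover bs cover xs) ⟩
    sum (map (λ b → count (Q? b) (x ∷ [])) bs) + sum (map (λ b → count (Q? b) xs) bs)
                                                             ≡⟨ sum-map-+ _ _ bs ⟨
    sum (map (λ b → count (Q? b) (x ∷ []) + count (Q? b) xs) bs)
                                                             ≡⟨ cong sum (map-cong (λ b → count-∷ (Q? b) x xs) bs) ⟨
    sum (map (λ b → count (Q? b) (x ∷ xs)) bs)               ∎
    where
    open ≤-Reasoning
    first : count P? (x ∷ []) ≤ sum (map (λ b → count (Q? b) (x ∷ [])) bs)
    first with P? x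
    ... | no  _  = z≤n
    ... | yes px with cover px
    ...   | b , b∈bs , qbx = ≤-trans (filter-some (Q? b) (here qbx)) (elem≤sum (λ b → count (Q? b) (x ∷ [])) b∈bs)

allPairs-++⁻ : {A : Set} {R : A → A → Set} (xs : List A) {ys : List A} → AllPairs R (xs ++ ys) →
               AllPairs R xs × AllPairs R ys × All (λ x → All (R x) ys) xs
allPairs-++⁻ []       pairs              = [] , pairs , []
allPairs-++⁻ (x ∷ xs) (x~xsys ∷ pairs) with allPairs-++⁻ xs pairs
... | pxs , pys , cross with AllP.++⁻ xs x~xsys
...   | x~xs , x~ys = x~xs ∷ pxs , pys , x~ys ∷ cross

weight-++ : {V : Set} (L M : List (WEdge V)) → weight (L ++ M) ≡ weight L + weight M
weight-++ L M = trans (cong sum (map-++ w L M)) (sum-++ (map w L) (map w M))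

weight-concatMap : {V B : Set} (A : B → List (WEdge V)) (bs : List B) →
                   weight (concatMap A bs) ≡ sum (map (weight ∘ A) bs)
weight-concatMap A []       = refl
weight-concatMap A (b ∷ bs) = trans (weight-++ (A b) (concatMap A bs)) (cong (weight (A b) +_) (weight-concatMap A bs))

weight-ʳ++ : {V : Set} (L M : List (WEdge V)) → weight (L ʳ++ M) ≡ weight L + weight M
weight-ʳ++ []      M = refl
weight-ʳ++ (e ∷ L) M = trans (weight-ʳ++ L (e ∷ M))
  (trans (sym (+-assoc (weight L) (w e) (weight M))) (cong (_+ weight M) (+-comm (weight L) (w e))))

module Greedy {V : Set} (eq? : DecidableEquality V) where

  Disjoint : WEdge V → WEdge V → Set
  Disjoint e f = ¬ Shares eq? e f

  Matching : List (WEdge V) → Set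
  Matching = AllPairs Disjoint

  -- Every edge meets itself, so choosing an edge removes it.
  shares-self : ∀ e → Shares eq? e e
  shares-self e = inj₁ (inj₁ refl)

  removeAll : List (WEdge V) → List (WEdge V) → List (WEdge V)
  removeAll []      E = E
  removeAll (e ∷ L) E = removeAll L (removeAdj eq? e E)

  ∈-removeAll⁺ : ∀ L {E f} → f ∈ E → All (λ e → Disjoint e f) L → f ∈ removeAll L E
  ∈-removeAll⁺ []      f∈E []         = f∈E
  ∈-removeAll⁺ (e ∷ L) f∈E (e#f ∷ L#f) =
    ∈-removeAll⁺ L (∈-filter⁺ (λ f → ¬? (shares? eq? e f)) f∈E e#f) L#f

  ∈-removeAll⁻ : ∀ L {E f} → f ∈ removeAll L E → f ∈ E × All (λ e → Disjoint e f) L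
  ∈-removeAll⁻ []      f∈ = f∈ , []
  ∈-removeAll⁻ (e ∷ L) f∈ with ∈-removeAll⁻ L f∈
  ... | f∈E' , L#f with ∈-filter⁻ (λ f → ¬? (shares? eq? e f)) f∈E'
  ...   | f∈E , e#f = f∈E , e#f ∷ L#f

  survivors : ∀ L {E K} → All (_∈ E) K → All (λ e → All (Disjoint e) K) L → All (_∈ removeAll L E) K
  survivors L K⊆E L#K = All.zipWith (λ (f∈E , L#f) → ∈-removeAll⁺ L f∈E L#f) (K⊆E , AllPC.All-swap L#K)

  pickAll : ∀ {x} L {E M E' M'} → All (λ e → w e ≡ x) L → All (_∈ E) L → Matching L →
            Phase eq? x (removeAll L E) (L ʳ++ M) E' M' → Phase eq? x E M E' M'
  pickAll []      _          _           _            phase = phase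
  pickAll (e ∷ L) {E} (we ∷ wL) (e∈E ∷ L⊆E) (e#L ∷ disjL) phase =
    pick e e∈E we (pickAll L wL (All.zipWith survive (L⊆E , e#L)) disjL phase)
    where
    survive : ∀ {f} → f ∈ E × Disjoint e f → f ∈ removeAdj eq? e E
    survive (f∈E , e#f) = ∈-filter⁺ (λ f → ¬? (shares? eq? e f)) f∈E e#f

  plannedPhase : ∀ {x L E M} → All (λ e → w e ≡ x) L → All (_∈ E) L → Matching L →
                 (∀ {f} → f ∈ E → w f ≡ x → Any (λ e → Shares eq? e f) L) →
                 Phase eq? x E M (removeAll L E) (L ʳ++ M)
  plannedPhase {L = L} wL L⊆E disjL dominated = pickAll L wL L⊆E disjL (stop leftover)
    where
    leftover : ¬ HasWeight eq? _ (removeAll L _)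
    leftover some with find some
    ... | f , f∈ , wf with ∈-removeAll⁻ L f∈
    ...   | f∈E , L#f with All.lookupAny L#f (dominated f∈E wf)
    ...     | e#f , e-meets-f = e#f e-meets-f

  finishPhase : ∀ x E M → Σ _ λ E' → Σ _ λ M' → Phase eq? x E M E' M' × weight M ≤ weight M'
  finishPhase x E M = go E M (suc (length E)) ≤-refl
    where
    go : ∀ E M k → length E < k → Σ _ λ E' → Σ _ λ M' → Phase eq? x E M E' M' × weight M ≤ weight M'
    go E M (suc k) bound with Any.any? (λ f → w f ≟ x) E
    ... | no none = E , M , stop none , ≤-refl
    ... | yes some with find some
    ...   | e , e∈E , we with go (removeAdj eq? e E) (e ∷ M) k (≤-trans shrink (≤-pred bound))
      where
      shrink : length (removeAdj eq? e E) < length E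
      shrink = filter-notAll (λ f → ¬? (shares? eq? e f)) E (lose e∈E (λ e#e → e#e (shares-self e)))
    ...   | E' , M' , phase , grows = E' , M' , pick e e∈E we phase , ≤-trans (m≤n+m _ _) grows

byDecision : {A : Set} (a? : Dec A) → {True a?} → A
byDecision _ {holds} = toWitness holds

-- Local coordinates around one gadget: a position on its path (β = 0, p = 1, …, t = 9)
-- or a clause vertex v_j.
data Loc (m : ℕ) : Set where
  at : Fin 10 → Loc m
  cl : Fin m → Loc m

module Local {m : ℕ} where

  -- Compares path positions first, so that comparisons of distinct positions evaluate
  -- even when clause indices are unknown.
  _≟ℓ_ : DecidableEquality (Loc m)
  at b ≟ℓ at b' = map′ (cong at) (λ { refl → refl }) (b ≟F b')
  at _ ≟ℓ cl _  = no λ ()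
  cl _ ≟ℓ at _  = no λ ()
  cl j ≟ℓ cl j' = map′ (cong cl) (λ { refl → refl }) (j ≟F j')

  open Greedy _≟ℓ_ public using () renaming (Disjoint to LocallyDisjoint; Matching to LocalMatching)

  pathWeight : Fin 9 → ℕ
  pathWeight 0F = 1
  pathWeight 1F = 3
  pathWeight 7F = 3
  pathWeight 8F = 1
  pathWeight _  = 4

  pathLocal : Fin 9 → WEdge (Loc m)
  pathLocal k = wedge (at (inject₁ k)) (at (Fin.suc k)) (pathWeight k)

  clauseα clauseβ clauseγ : Fin m → WEdge (Loc m)
  clauseα j = wedge (cl j) (at α) 3
  clauseβ j = wedge (cl j) (at β) 1
  clauseγ j = wedge (cl j) (at γ) 3

  Covers : List (WEdge (Loc m)) → Loc m → Set
  Covers L x = Any (λ e → u e ≡ x ⊎ v e ≡ x) L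

  Touches : List (WEdge (Loc m)) → WEdge (Loc m) → Set
  Touches L f = Covers L (u f) ⊎ Covers L (v f)

  covers? : ∀ L x → Dec (Covers L x)
  covers? L x = Any.any? (λ e → (u e ≟ℓ x) ⊎-dec (v e ≟ℓ x)) L

  touches? : ∀ L f → Dec (Touches L f)
  touches? L f = covers? L (u f) ⊎-dec covers? L (v f)

  disjoint? : ∀ e f → Dec (LocallyDisjoint e f)
  disjoint? e f = ¬? (shares? _≟ℓ_ e f)

  matching? : ∀ L → Dec (LocalMatching L)
  matching? = allPairs? disjoint?

  touches-++⁻ : ∀ H M {f} → Touches (H ++ M) f → Touches H f ⊎ Touches M f
  touches-++⁻ H M (inj₁ covers-u) = Data.Sum.map inj₁ inj₁ (AnyP.++⁻ H covers-u)
  touches-++⁻ H M (inj₂ covers-v) = Data.Sum.map inj₂ inj₂ (AnyP.++⁻ H covers-v)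

  -- The requirements on the heavy (weight 4), middle (weight 3) and light (weight 1) edges
  -- planned for one gadget, apart from being a matching: the heavy edges meet every path
  -- edge of weight 4, and the heavy and middle edges together meet every path edge of
  -- weight 3 and cover α and γ (hence meet every clause edge of weight 3).
  record ShapeOK (H M L : List (WEdge (Loc m))) : Set where
    field
      heavy-weights    : All (λ e → w e ≡ 4) H
      middle-weights   : All (λ e → w e ≡ 3) M
      light-weights    : All (λ e → w e ≡ 1) L
      heavy-dominates  : ∀ k → pathWeight k ≡ 4 → Touches H (pathLocal k)
      middle-dominates : ∀ k → pathWeight k ≡ 3 → Touches (H ++ M) (pathLocal k)
      covers-α         : Covers (H ++ M) (at α)
      covers-γ         : Covers (H ++ M) (at γ)

  shapeOK? : ∀ H M L → Dec (ShapeOK H M L)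
  shapeOK? H M L = map′ toShape fromShape
    (All.all? (λ e → w e ≟ 4) H ×-dec All.all? (λ e → w e ≟ 3) M ×-dec All.all? (λ e → w e ≟ 1) L ×-dec
     Fin.all? (λ k → (pathWeight k ≟ 4) →-dec touches? H (pathLocal k)) ×-dec
     Fin.all? (λ k → (pathWeight k ≟ 3) →-dec touches? (H ++ M) (pathLocal k)) ×-dec
     covers? (H ++ M) (at α) ×-dec covers? (H ++ M) (at γ))
    where
    toShape = λ (wH , wM , wL , dH , dM , cα , cγ) → record
      { heavy-weights = wH ; middle-weights = wM ; light-weights = wL
      ; heavy-dominates = dH ; middle-dominates = dM ; covers-α = cα ; covers-γ = cγ }
    fromShape = λ (ok : ShapeOK H M L) → let open ShapeOK ok in
      heavy-weights , middle-weights , light-weights , heavy-dominates , middle-dominates , covers-α , covers-γ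

module Graph {n m : ℕ} (φ : Formula n m) where
  open Local {m}

  place : Fin n → Loc m → Vtx n m
  place i (at b) = gad i b
  place i (cl j) = cls j

  realize : Fin n → WEdge (Loc m) → WEdge (Vtx n m)
  realize i e = wedge (place i (u e)) (place i (v e)) (w e)

  place-injective : ∀ {i x y} → place i x ≡ place i y → x ≡ y
  place-injective {x = at _} {at _} refl = refl
  place-injective {x = cl _} {cl _} refl = refl

  realize-disjoint : ∀ {i e f} → LocallyDisjoint e f → Greedy.Disjoint _≟V_ (realize i e) (realize i f)
  realize-disjoint e#f meet = e#f (Data.Sum.map (Data.Sum.map place-injective place-injective)
                                                  (Data.Sum.map place-injective place-injective) meet)

  realize-shares : ∀ {i L f} → Touches L f → Any (λ e → Shares _≟V_ (realize i e) (realize i f)) L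
  realize-shares {i} (inj₁ covers-u) = Any.map (Data.Sum.map (inj₁ ∘ cong (place i)) (inj₁ ∘ cong (place i))) covers-u
  realize-shares {i} (inj₂ covers-v) = Any.map (Data.Sum.map (inj₂ ∘ cong (place i)) (inj₂ ∘ cong (place i))) covers-v

  private
    clause-in : ∀ {i j f} → f ∈ clauseEdges φ i j → f ∈ graphG φ
    clause-in {i} {j} f∈ = ∈-++⁺ʳ (concatMap pathEdges (allFin n))
      (∈-concatMap⁺ (λ j → concatMap (λ i → clauseEdges φ i j) (allFin n))
        (lose (∈-allFin j) (∈-concatMap⁺ (λ i → clauseEdges φ i j) (lose (∈-allFin i) f∈))))

    posE-in : ∀ {i j} {P : Set} (d : Dec P) → P → realize i (clauseα j) ∈ posE i j d
    posE-in (yes _) _   = here refl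
    posE-in (no ∉)  mem = ⊥-elim (∉ mem)

    negE-in₀ : ∀ {i j k} {P : Set} (d : Dec P) → P → k ≡ 0 → realize i (clauseβ j) ∈ negE i j d k
    negE-in₀ (yes _) _   refl = here refl
    negE-in₀ (no ∉)  mem _    = ⊥-elim (∉ mem)

    negE-in₁ : ∀ {i j k} {P : Set} (d : Dec P) → P → k ≡ 1 → realize i (clauseγ j) ∈ negE i j d k
    negE-in₁ (yes _) _   refl = here refl
    negE-in₁ (no ∉)  mem _    = ⊥-elim (∉ mem)

  path-in : ∀ i k → realize i (pathLocal k) ∈ graphG φ
  path-in i k = ∈-++⁺ˡ (∈-concatMap⁺ pathEdges (lose (∈-allFin i) (∈-map⁺ (realize i ∘ pathLocal) (∈-allFin k))))

  clauseα-in : ∀ {i j} → (i , true) ∈ lookup φ j → realize i (clauseα j) ∈ graphG φ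
  clauseα-in {i} {j} mem = clause-in {i} {j} (∈-++⁺ˡ (posE-in ((i , true) ∈L? lookup φ j) mem))

  clauseβ-in : ∀ {i j} → (i , false) ∈ lookup φ j → negBefore φ i j ≡ 0 → realize i (clauseβ j) ∈ graphG φ
  clauseβ-in {i} {j} mem first = clause-in {i} {j}
    (∈-++⁺ʳ (posE i j ((i , true) ∈L? lookup φ j)) (negE-in₀ ((i , false) ∈L? lookup φ j) mem first))

  clauseγ-in : ∀ {i j} → (i , false) ∈ lookup φ j → negBefore φ i j ≡ 1 → realize i (clauseγ j) ∈ graphG φ
  clauseγ-in {i} {j} mem second = clause-in {i} {j}
    (∈-++⁺ʳ (posE i j ((i , true) ∈L? lookup φ j)) (negE-in₁ ((i , false) ∈L? lookup φ j) mem second))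

  data Classified (f : WEdge (Vtx n m)) : Set where
    path-edge    : ∀ i k → f ≡ realize i (pathLocal k) → Classified f
    clause-edgeα : ∀ i j → f ≡ realize i (clauseα j)   → Classified f
    clause-edgeβ : ∀ i j → f ≡ realize i (clauseβ j)   → Classified f
    clause-edgeγ : ∀ i j → f ≡ realize i (clauseγ j)   → Classified f

  classify : ∀ {f} → f ∈ graphG φ → Classified f
  classify f∈ with ∈-++⁻ (concatMap pathEdges (allFin n)) f∈
  ... | inj₁ f∈paths with find (∈-concatMap⁻ pathEdges {allFin n} f∈paths)
  ...   | i , _ , f∈path with ∈-map⁻ (realize i ∘ pathLocal) f∈path
  ...     | k , _ , refl = path-edge i k refl
  classify f∈ | inj₂ f∈clauses
    with find (∈-concatMap⁻ (λ j → concatMap (λ i → clauseEdges φ i j) (allFin n)) {allFin m} f∈clauses)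
  ... | j , _ , f∈j with find (∈-concatMap⁻ (λ i → clauseEdges φ i j) {allFin n} f∈j)
  ...   | i , _ , f∈ij with ∈-++⁻ (posE i j ((i , true) ∈L? lookup φ j)) f∈ij
  ...     | inj₁ f∈pos = fromPos ((i , true) ∈L? lookup φ j) f∈pos
    where
    fromPos : ∀ {P : Set} (d : Dec P) → _ ∈ posE i j d → Classified _
    fromPos (yes _) (here refl) = clause-edgeα i j refl
  ...     | inj₂ f∈neg = fromNeg ((i , false) ∈L? lookup φ j) (negBefore φ i j) f∈neg
    where
    fromNeg : ∀ {P : Set} (d : Dec P) k → _ ∈ negE i j d k → Classified _
    fromNeg (yes _) zero          (here refl) = clause-edgeβ i j refl
    fromNeg (yes _) (suc zero)    (here refl) = clause-edgeγ i j refl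

  weights-of-G : 0 < n → ∀ x → (x ∈ 4 ∷ 3 ∷ 1 ∷ []) ⇔ HasWeight _≟V_ x (graphG φ)
  weights-of-G (s≤s z≤n) x = mk⇔ occurs from
    where
    occurs : x ∈ 4 ∷ 3 ∷ 1 ∷ [] → HasWeight _≟V_ x (graphG φ)
    occurs (here refl)                 = lose (path-in Fin.zero 2F) refl
    occurs (there (here refl))         = lose (path-in Fin.zero 1F) refl
    occurs (there (there (here refl))) = lose (path-in Fin.zero 0F) refl
    from : HasWeight _≟V_ x (graphG φ) → x ∈ 4 ∷ 3 ∷ 1 ∷ []
    from some with find some
    ... | f , f∈ , refl with classify f∈
    ...   | path-edge _ k refl    = byDecision (Fin.all? (λ k → pathWeight k ∈? 4 ∷ 3 ∷ 1 ∷ [])) k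
    ...   | clause-edgeα _ _ refl = there (here refl)
    ...   | clause-edgeβ _ _ refl = there (there (here refl))
    ...   | clause-edgeγ _ _ refl = there (here refl)

  empty-greedy : n ≡ 0 → IsGreedyMatching _≟V_ (graphG φ) []
  empty-greedy refl = [] , [] , (λ x → mk⇔ (λ ()) no-edge) , done
    where
    no-edge : ∀ {x} → HasWeight _≟V_ x (graphG φ) → x ∈ []
    no-edge some with find some
    ... | f , f∈ , _ with classify f∈
    ...   | path-edge () _ _
    ...   | clause-edgeα () _ _
    ...   | clause-edgeβ () _ _
    ...   | clause-edgeγ () _ _

module Reduction {n m : ℕ} (φ : Formula n m) (a : Assignment n) where
  open Local {m}
  open Graph φ
  open Greedy (_≟V_ {n} {m})

  credited : Fin m → Maybe (Fin n)
  credited j with satisfies? a (lookup φ j)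
  ... | yes sat = just (proj₁ (proj₁ (find sat)))
  ... | no  _   = nothing

  credited-sound : ∀ {i j} → credited j ≡ just i → (i , a i) ∈ lookup φ j
  credited-sound {j = j} eq with satisfies? a (lookup φ j)
  ... | yes sat with find sat | eq
  ...   | (i , b) , lit∈ , ai≡b | refl = subst (λ c → (i , c) ∈ lookup φ j) (sym ai≡b) lit∈

  credited-complete : ∀ {j} → Any (λ l → a (proj₁ l) ≡ proj₂ l) (lookup φ j) → ∃ λ i → credited j ≡ just i
  credited-complete {j} sat with satisfies? a (lookup φ j)
  ... | yes _    = _ , refl
  ... | no unsat = ⊥-elim (unsat sat)

  _≟M_ : DecidableEquality (Maybe (Fin n))
  _≟M_ = ≡-decMaybe _≟F_

  credits : Fin n → ℕ
  credits i = count (λ j → credited j ≟M just i) (allFin m)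

  satisfied≤credits : numSat φ a ≤ sum (map credits (allFin n))
  satisfied≤credits = count-cover (λ j → satisfies? a (lookup φ j)) (λ i j → credited j ≟M just i) (allFin n)
    (λ sat → let i , c = credited-complete sat in i , ∈-allFin i , c) (allFin m)

  owner : Vtx n m → Maybe (Fin n)
  owner (gad i _) = just i
  owner (cls j)   = credited j

  OwnedBy : Fin n → WEdge (Vtx n m) → Set
  OwnedBy i e = owner (u e) ≡ just i × owner (v e) ≡ just i

  owned-disjoint : ∀ {i i' e f} → ¬ i ≡ i' → OwnedBy i e → OwnedBy i' f → Disjoint e f
  owned-disjoint {i} {i'} i≢i' (own-ue , own-ve) (own-uf , own-vf) =
    [ [ apart own-ue own-uf , apart own-ue own-vf ] , [ apart own-ve own-uf , apart own-ve own-vf ] ]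
    where
    apart : ∀ {x y} → owner x ≡ just i → owner y ≡ just i' → ¬ x ≡ y
    apart own-x own-y refl = i≢i' (just-injective (trans (sym own-x) own-y))

  data GEdge (i : Fin n) : Set where
    path : Fin 9 → GEdge i
    viaα : ∀ j → credited j ≡ just i → (i , true) ∈ lookup φ j → GEdge i
    viaβ : ∀ j → credited j ≡ just i → (i , false) ∈ lookup φ j → negBefore φ i j ≡ 0 → GEdge i
    viaγ : ∀ j → credited j ≡ just i → (i , false) ∈ lookup φ j → negBefore φ i j ≡ 1 → GEdge i

  module _ {i : Fin n} where

    localEdge : GEdge i → WEdge (Loc m)
    localEdge (path k)       = pathLocal k
    localEdge (viaα j _ _)   = clauseα j
    localEdge (viaβ j _ _ _) = clauseβ j
    localEdge (viaγ j _ _ _) = clauseγ j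

    locals : List (GEdge i) → List (WEdge (Loc m))
    locals = map localEdge

    edge : GEdge i → WEdge (Vtx n m)
    edge = realize i ∘ localEdge

    edge-in : ∀ g → edge g ∈ graphG φ
    edge-in (path k)              = path-in i k
    edge-in (viaα _ _ pos)        = clauseα-in pos
    edge-in (viaβ _ _ neg first)  = clauseβ-in neg first
    edge-in (viaγ _ _ neg second) = clauseγ-in neg second

    edge-owned : ∀ g → OwnedBy i (edge g)
    edge-owned (path _)       = refl , refl
    edge-owned (viaα _ c _)   = c , refl
    edge-owned (viaβ _ c _ _) = c , refl
    edge-owned (viaγ _ c _ _) = c , refl

  record Plan (i : Fin n) : Set where
    field
      heavy middle light : List (GEdge i)
      bonus    : ℕ
      shape    : ShapeOK (locals heavy) (locals middle) (locals light)
      matching : LocalMatching (locals (heavy ++ middle ++ light))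
      total    : weight (map edge heavy) + weight (map edge middle) + weight (map edge light) ≡ 14 + bonus

  -- Positions: β=0 p=1 q=2 r=3 α=4 γ=5 y=6 z=7 s=8 t=9; path k joins positions k and k+1.

  -- No clause credited to x_i: q-r, α-γ, y-z, then β-p, s-t.
  nonePlan : ∀ {i} → Plan i
  nonePlan = record
    { heavy = path 2F ∷ path 4F ∷ path 6F ∷ [] ; middle = [] ; light = path 0F ∷ path 8F ∷ []
    ; bonus = 0 ; shape = byDecision (shapeOK? _ _ _) ; matching = byDecision (matching? _) ; total = refl }

  -- x_i true, credited with C_j ∋ x_i: q-r, γ-y, then z-s, v_j-α, then β-p.
  positivePlan : ∀ {i} j → credited j ≡ just i → (i , true) ∈ lookup φ j → Plan i
  positivePlan j c pos = record
    { heavy = path 2F ∷ path 5F ∷ [] ; middle = path 7F ∷ viaα j c pos ∷ [] ; light = path 0F ∷ []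
    ; bonus = 1 ; shape = byDecision (shapeOK? _ _ _) ; matching = byDecision (matching? _) ; total = refl }

  -- x_i false, credited with its first negative clause C_j: r-α, γ-y, then p-q, z-s, then v_j-β.
  firstNegPlan : ∀ {i} j → credited j ≡ just i → (i , false) ∈ lookup φ j → negBefore φ i j ≡ 0 → Plan i
  firstNegPlan j c neg first = record
    { heavy = path 3F ∷ path 5F ∷ [] ; middle = path 1F ∷ path 7F ∷ [] ; light = viaβ j c neg first ∷ []
    ; bonus = 1 ; shape = byDecision (shapeOK? _ _ _) ; matching = byDecision (matching? _) ; total = refl }

  -- x_i false, credited with its second negative clause C_j: r-α, y-z, then p-q, v_j-γ, then s-t.
  secondNegPlan : ∀ {i} j → credited j ≡ just i → (i , false) ∈ lookup φ j → negBefore φ i j ≡ 1 → Plan i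
  secondNegPlan j c neg second = record
    { heavy = path 3F ∷ path 6F ∷ [] ; middle = path 1F ∷ viaγ j c neg second ∷ [] ; light = path 8F ∷ []
    ; bonus = 1 ; shape = byDecision (shapeOK? _ _ _) ; matching = byDecision (matching? _) ; total = refl }

  -- x_i false, credited with both negative clauses: as before, adding v_{j₁}-β in the last phase.
  -- The two clause edges are disjoint because the clauses differ; all other pairs by evaluation.
  bothNegPlan : ∀ {i} j₂ j₁ → ¬ j₂ ≡ j₁ →
                credited j₂ ≡ just i → (i , false) ∈ lookup φ j₂ → negBefore φ i j₂ ≡ 1 →
                credited j₁ ≡ just i → (i , false) ∈ lookup φ j₁ → negBefore φ i j₁ ≡ 0 → Plan i
  bothNegPlan j₂ j₁ j₂≢j₁ c₂ neg₂ second c₁ neg₁ first = record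
    { heavy = path 3F ∷ path 6F ∷ [] ; middle = path 1F ∷ viaγ j₂ c₂ neg₂ second ∷ []
    ; light = path 8F ∷ viaβ j₁ c₁ neg₁ first ∷ []
    ; bonus = 2 ; shape = byDecision (shapeOK? _ _ _)
    ; matching = byDecision (All.all? (disjoint? (pathLocal 3F)) _)
               ∷ byDecision (All.all? (disjoint? (pathLocal 6F)) _)
               ∷ byDecision (All.all? (disjoint? (pathLocal 1F)) _)
               ∷ (byDecision (disjoint? (clauseγ j₂) (pathLocal 8F)) ∷ γ#β ∷ [])
               ∷ byDecision (matching? _)
    ; total = refl }
    where
    γ#β : LocallyDisjoint (clauseγ j₂) (clauseβ j₁)
    γ#β (inj₁ (inj₁ refl)) = j₂≢j₁ refl
    γ#β (inj₁ (inj₂ ()))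
    γ#β (inj₂ (inj₁ ()))
    γ#β (inj₂ (inj₂ ()))

  module Assembly (plan : (i : Fin n) → Plan i) where
    open Plan
    open ShapeOK

    Selector : Set
    Selector = ∀ {i} → Plan i → List (GEdge i)

    phase : Selector → List (WEdge (Vtx n m))
    phase sel = concatMap (λ i → map edge (sel (plan i))) (allFin n)

    Heavy Middle Light : List (WEdge (Vtx n m))
    Heavy  = phase heavy
    Middle = phase middle
    Light  = phase light

    ∈-phase⁺ : ∀ (sel : Selector) {i g} → g ∈ sel (plan i) → edge g ∈ phase sel
    ∈-phase⁺ sel {i} g∈ = ∈-concatMap⁺ (λ i → map edge (sel (plan i))) (lose (∈-allFin i) (∈-map⁺ edge g∈))

    phase-all : ∀ (sel : Selector) {P : WEdge (Vtx n m) → Set} →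
                (∀ {i} {g : GEdge i} → g ∈ sel (plan i) → P (edge g)) → All P (phase sel)
    phase-all sel {P} h = All.tabulate planned
      where
      planned : ∀ {f} → f ∈ phase sel → P f
      planned f∈ with find (∈-concatMap⁻ (λ i → map edge (sel (plan i))) {allFin n} f∈)
      ... | i , _ , f∈i with ∈-map⁻ edge f∈i
      ...   | g , g∈ , refl = h g∈

    phase-in-G : ∀ (sel : Selector) → All (_∈ graphG φ) (phase sel)
    phase-in-G sel = phase-all sel (λ {_} {g} _ → edge-in g)

    phase-weights : ∀ (sel : Selector) x → (∀ i → All (λ e → w e ≡ x) (locals (sel (plan i)))) →
                    All (λ e → w e ≡ x) (phase sel)
    phase-weights sel x weights = phase-all sel (λ {i} g∈ → All.lookup (weights i) (∈-map⁺ localEdge g∈))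

    Apart : ∀ {i} → GEdge i → GEdge i → Set
    Apart g g' = Disjoint (edge g) (edge g')

    -- A phase is a matching if it is one inside each gadget, as different gadgets are apart.
    phase-matching : ∀ (sel : Selector) → (∀ i → AllPairs Apart (sel (plan i))) → Matching (phase sel)
    phase-matching sel inside = AllPairsP.concat⁺
      (AllP.map⁺ (All.tabulate λ {i} _ → AllPairsP.map⁺ (inside i)))
      (AllPairsP.map⁺ (AllPairs.map between (allFin⁺ n)))
      where
      owned : ∀ i → All (OwnedBy i) (map edge (sel (plan i)))
      owned i = AllP.map⁺ (All.universal edge-owned (sel (plan i)))
      between : ∀ {i i'} → ¬ i ≡ i' →
                All (λ e → All (Disjoint e) (map edge (sel (plan i')))) (map edge (sel (plan i)))
      between {i} {i'} i≢i' =
        All.map (λ {e} own-e → All.map (λ {f} → owned-disjoint {e = e} {f} i≢i' own-e) (owned i')) (owned i)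

    phase-cross : ∀ (sel sel' : Selector) → (∀ i → All (λ g → All (Apart g) (sel' (plan i))) (sel (plan i))) →
                  All (λ e → All (Disjoint e) (phase sel')) (phase sel)
    phase-cross sel sel' inside = phase-all sel λ {i} {g} g∈ → phase-all sel' λ {i'} {g'} g'∈ → apart g∈ g'∈
      where
      apart : ∀ {i i'} {g : GEdge i} {g' : GEdge i'} → g ∈ sel (plan i) → g' ∈ sel' (plan i') →
              Disjoint (edge g) (edge g')
      apart {i} {i'} {g} {g'} g∈ g'∈ with i ≟F i'
      ... | yes refl = All.lookup (All.lookup (inside i) g∈) g'∈
      ... | no i≢i'  = owned-disjoint {e = edge g} {edge g'} i≢i' (edge-owned g) (edge-owned g')

    module _ (i : Fin n) where
      private
        H = heavy (plan i) ; M = middle (plan i) ; L = light (plan i)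

        gadget-pairs : AllPairs Apart (H ++ M ++ L)
        gadget-pairs = AllPairs.map (λ {g} {g'} → realize-disjoint {i} {localEdge g} {localEdge g'})
                                    (AllPairsP.map⁻ (matching (plan i)))

        rest-pairs : AllPairs Apart (M ++ L)
        rest-pairs = proj₁ (proj₂ (allPairs-++⁻ H gadget-pairs))

        heavy-rest : All (λ g → All (Apart g) (M ++ L)) H
        heavy-rest = proj₂ (proj₂ (allPairs-++⁻ H gadget-pairs))

      heavy-pairs : AllPairs Apart H
      heavy-pairs = proj₁ (allPairs-++⁻ H gadget-pairs)

      middle-pairs : AllPairs Apart M
      middle-pairs = proj₁ (allPairs-++⁻ M rest-pairs)

      light-pairs : AllPairs Apart L
      light-pairs = proj₁ (proj₂ (allPairs-++⁻ M rest-pairs))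

      heavy-middle : All (λ g → All (Apart g) M) H
      heavy-middle = All.map (proj₁ ∘ AllP.++⁻ M) heavy-rest

      heavy-light : All (λ g → All (Apart g) L) H
      heavy-light = All.map (proj₂ ∘ AllP.++⁻ M) heavy-rest

      middle-light : All (λ g → All (Apart g) L) M
      middle-light = proj₂ (proj₂ (allPairs-++⁻ M rest-pairs))

    meets : ∀ (sel : Selector) i f → Touches (locals (sel (plan i))) f →
            Any (λ e → Shares _≟V_ e (realize i f)) (phase sel)
    meets sel i f touch with find (realize-shares {i} {locals (sel (plan i))} {f} touch)
    ... | e , e∈ , e-meets with ∈-map⁻ localEdge e∈
    ...   | g , g∈ , refl = lose (∈-phase⁺ sel g∈) e-meets

    heavy-dominates-G : ∀ {f} → f ∈ graphG φ → w f ≡ 4 → Any (λ e → Shares _≟V_ e f) Heavy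
    heavy-dominates-G f∈ wf with classify f∈
    ... | path-edge i k refl    = meets heavy i (pathLocal k) (heavy-dominates (shape (plan i)) k wf)
    ... | clause-edgeα _ _ refl = contradiction wf λ ()
    ... | clause-edgeβ _ _ refl = contradiction wf λ ()
    ... | clause-edgeγ _ _ refl = contradiction wf λ ()

    meets-middle : ∀ i f → All (λ e → Disjoint e (realize i f)) Heavy →
                   Touches (locals (heavy (plan i)) ++ locals (middle (plan i))) f →
                   Any (λ e → Shares _≟V_ e (realize i f)) Middle
    meets-middle i f Heavy#f touch with touches-++⁻ (locals (heavy (plan i))) (locals (middle (plan i))) {f} touch
    ... | inj₂ touch-middle = meets middle i f touch-middle
    ... | inj₁ touch-heavy with All.lookupAny Heavy#f (meets heavy i f touch-heavy)
    ...   | e#f , e-meets-f = contradiction e-meets-f e#f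

    middle-dominates-G : ∀ {f} → f ∈ removeAll Heavy (graphG φ) → w f ≡ 3 → Any (λ e → Shares _≟V_ e f) Middle
    middle-dominates-G f∈ wf with ∈-removeAll⁻ Heavy f∈
    ... | f∈G , Heavy#f with classify f∈G
    ...   | path-edge i k refl    = meets-middle i (pathLocal k) Heavy#f (middle-dominates (shape (plan i)) k wf)
    ...   | clause-edgeα i j refl = meets-middle i (clauseα j) Heavy#f (inj₂ (covers-α (shape (plan i))))
    ...   | clause-edgeβ _ _ refl = contradiction wf λ ()
    ...   | clause-edgeγ i j refl = meets-middle i (clauseγ j) Heavy#f (inj₂ (covers-γ (shape (plan i))))

    heavy-phase : Phase _≟V_ 4 (graphG φ) [] (removeAll Heavy (graphG φ)) (Heavy ʳ++ [])
    heavy-phase = plannedPhase (phase-weights heavy 4 (λ i → heavy-weights (shape (plan i))))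
      (phase-in-G heavy) (phase-matching heavy heavy-pairs) heavy-dominates-G

    middle-phase : Phase _≟V_ 3 (removeAll Heavy (graphG φ)) (Heavy ʳ++ [])
                     (removeAll Middle (removeAll Heavy (graphG φ))) (Middle ʳ++ Heavy ʳ++ [])
    middle-phase = plannedPhase (phase-weights middle 3 (λ i → middle-weights (shape (plan i))))
      (survivors Heavy (phase-in-G middle) (phase-cross heavy middle heavy-middle))
      (phase-matching middle middle-pairs) middle-dominates-G

    -- After choosing the light edges the last phase is finished greedily in any way.
    greedy-run : Σ _ λ M → Run _≟V_ (4 ∷ 3 ∷ 1 ∷ []) (graphG φ) [] M ×
                           weight Heavy + weight Middle + weight Light ≤ weight M
    greedy-run with finishPhase 1 (removeAll Light (removeAll Middle (removeAll Heavy (graphG φ))))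
                                  (Light ʳ++ Middle ʳ++ Heavy ʳ++ [])
    ... | _ , M , light-rest , grows =
      M , next heavy-phase (next middle-phase (next light-phase done)) , ≤-trans (≤-reflexive chosen) grows
      where
      light-in : All (_∈ removeAll Middle (removeAll Heavy (graphG φ))) Light
      light-in = survivors Middle (survivors Heavy (phase-in-G light) (phase-cross heavy light heavy-light))
                   (phase-cross middle light middle-light)
      light-phase = pickAll Light (phase-weights light 1 (λ i → light-weights (shape (plan i)))) light-in
                      (phase-matching light light-pairs) light-rest
      chosen : weight Heavy + weight Middle + weight Light ≡ weight (Light ʳ++ Middle ʳ++ Heavy ʳ++ [])
      chosen = begin
        weight Heavy + weight Middle + weight Light
          ≡⟨ rearrange (weight Heavy) (weight Middle) (weight Light) ⟩
        weight Light + (weight Middle + (weight Heavy + 0))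
          ≡⟨ cong (λ x → weight Light + (weight Middle + x)) (weight-ʳ++ Heavy []) ⟨
        weight Light + (weight Middle + weight (Heavy ʳ++ []))
          ≡⟨ cong (weight Light +_) (weight-ʳ++ Middle _) ⟨
        weight Light + weight (Middle ʳ++ Heavy ʳ++ [])
          ≡⟨ weight-ʳ++ Light _ ⟨
        weight (Light ʳ++ Middle ʳ++ Heavy ʳ++ []) ∎
        where
        open ≡-Reasoning
        rearrange : ∀ h m l → h + m + l ≡ l + (m + (h + 0))
        rearrange = solve-∀

    planned-weight : weight Heavy + weight Middle + weight Light ≡ 14 * n + sum (map (bonus ∘ plan) (allFin n))
    planned-weight = begin
      weight Heavy + weight Middle + weight Light
        ≡⟨ cong₂ _+_ (cong₂ _+_ (weight-concatMap _ (allFin n)) (weight-concatMap _ (allFin n)))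
                     (weight-concatMap _ (allFin n)) ⟩
      sum (map wH (allFin n)) + sum (map wM (allFin n)) + sum (map wL (allFin n))
        ≡⟨ cong (_+ sum (map wL (allFin n))) (sum-map-+ wH wM (allFin n)) ⟨
      sum (map (λ i → wH i + wM i) (allFin n)) + sum (map wL (allFin n))
        ≡⟨ sum-map-+ (λ i → wH i + wM i) wL (allFin n) ⟨
      sum (map (λ i → wH i + wM i + wL i) (allFin n))
        ≡⟨ cong sum (map-cong (total ∘ plan) (allFin n)) ⟩
      sum (map (λ i → 14 + bonus (plan i)) (allFin n))
        ≡⟨ sum-map-+ (λ _ → 14) (bonus ∘ plan) (allFin n) ⟩
      sum (map (λ _ → 14) (allFin n)) + sum (map (bonus ∘ plan) (allFin n))
        ≡⟨ cong (_+ sum (map (bonus ∘ plan) (allFin n)))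
                (trans (sum-const 14 (allFin n)) (cong (14 *_) (length-tabulate {n = n} id))) ⟩
      14 * n + sum (map (bonus ∘ plan) (allFin n)) ∎
      where
      open ≡-Reasoning
      wH wM wL : Fin n → ℕ
      wH i = weight (map edge (heavy (plan i)))
      wM i = weight (map edge (middle (plan i)))
      wL i = weight (map edge (light (plan i)))

    greedy-matching : 0 < n → Σ _ λ M → IsGreedyMatching _≟V_ (graphG φ) M ×
                                       14 * n + sum (map (bonus ∘ plan) (allFin n)) ≤ weight M
    greedy-matching 0<n with greedy-run
    ... | M , run , heavier = M , (4 ∷ 3 ∷ 1 ∷ [] , n<1+n 3 ∷ s≤s (s≤s z≤n) ∷ [-] , weights-of-G 0<n , run) ,
                              ≤-trans (≤-reflexive (sym planned-weight)) heavier

  module Counting (wf : WellFormed φ) where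

    containing : Lit n → ℕ
    containing l = count (λ j → l ∈L? lookup φ j) (allFin m)

    containing≤occ : ∀ l → containing l ≤ occ φ l
    containing≤occ l = count-≤-sum (λ j → l ∈L? lookup φ j) _ (filter-some (l ≟L_)) (allFin m)

    credits≤occ : ∀ i → credits i ≤ occ φ (i , a i)
    credits≤occ i = ≤-trans (count-mono _ _ credited-sound (allFin m)) (containing≤occ (i , a i))

    negative-occ≤2 : ∀ i → occ φ (i , false) ≤ 2
    negative-occ≤2 i with proj₂ (proj₂ wf i)
    ... | inj₁ once  = ≤-trans (≤-reflexive once) (m≤n+m 1 1)
    ... | inj₂ twice = ≤-reflexive twice

    private
      before? : (i : Fin n) (j : Fin m) → Decidable (λ j' → toℕ j' < toℕ j × (i , false) ∈ lookup φ j')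
      before? i j j' = (toℕ j' <? toℕ j) ×-dec ((i , false) ∈L? lookup φ j')

    negBefore-< : ∀ {i j j'} → (i , false) ∈ lookup φ j → toℕ j < toℕ j' → negBefore φ i j < negBefore φ i j'
    negBefore-< {i} {j} {j'} neg j<j' = count-strict (before? i j) (before? i j')
      (λ (earlier , mem) → <-trans earlier j<j' , mem) (∈-allFin j) (j<j' , neg) (λ (earlier , _) → <-irrefl refl earlier)

    negBefore-injective : ∀ {i j j'} → (i , false) ∈ lookup φ j → (i , false) ∈ lookup φ j' →
                          negBefore φ i j ≡ negBefore φ i j' → j ≡ j'
    negBefore-injective {j = j} {j'} neg neg' same with <-cmp (toℕ j) (toℕ j')
    ... | tri< j<j' _ _ = contradiction same (λ eq → <-irrefl eq (negBefore-< neg j<j'))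
    ... | tri≈ _ j≡j' _ = Fin.toℕ-injective j≡j'
    ... | tri> _ _ j>j' = contradiction (sym same) (λ eq → <-irrefl eq (negBefore-< neg' j>j'))

    -- As ¬x_i occurs at most twice, these ranks are 0 or 1.
    negBefore≤1 : ∀ {i j} → (i , false) ∈ lookup φ j → negBefore φ i j ≤ 1
    negBefore≤1 {i} {j} neg = ≤-pred (≤-trans
      (count-strict (before? i j) (λ j' → (i , false) ∈L? lookup φ j') proj₂ (∈-allFin j) neg
                    (λ (earlier , _) → <-irrefl refl earlier))
      (≤-trans (containing≤occ (i , false)) (negative-occ≤2 i)))

    uncredited : ∀ {i} → (∀ j → ¬ credited j ≡ just i) → credits i ≡ 0
    uncredited {i} none = count-none (λ j → credited j ≟M just i) {allFin m} (All.tabulate λ {j} _ → none j)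

    -- The plan for a false variable depends on which ranks of its credited clauses occur.
    module Negative {i} (ai : a i ≡ false) where

      negative : ∀ {j} → credited j ≡ just i → (i , false) ∈ lookup φ j
      negative c = subst (λ b → (i , b) ∈ lookup φ _) ai (credited-sound c)

      rank : ∀ {j} → credited j ≡ just i → negBefore φ i j ≡ 0 ⊎ negBefore φ i j ≡ 1
      rank {j} c with negBefore φ i j | negBefore≤1 (negative c)
      ... | zero     | _ = inj₁ refl
      ... | suc zero | _ = inj₂ refl
      ... | suc (suc _) | s≤s ()

      single-rank : ∀ {r} → (∀ {j} → credited j ≡ just i → negBefore φ i j ≡ r) → credits i ≤ 1
      single-rank same = count-≤1 _ (λ c c' → negBefore-injective (negative c) (negative c') (trans (same c) (sym (same c'))))
                                  (allFin⁺ m)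

      plan : Σ (Plan i) λ P → credits i ≤ Plan.bonus P
      plan with Fin.any? (λ j → (credited j ≟M just i) ×-dec (negBefore φ i j ≟ 0))
              | Fin.any? (λ j → (credited j ≟M just i) ×-dec (negBefore φ i j ≟ 1))
      ... | yes (j₁ , c₁ , r₁) | yes (j₂ , c₂ , r₂) =
        bothNegPlan j₂ j₁ (λ { refl → contradiction (trans (sym r₂) r₁) λ () })
                    c₂ (negative c₂) r₂ c₁ (negative c₁) r₁ ,
        ≤-trans (credits≤occ i) (subst (λ b → occ φ (i , b) ≤ 2) (sym ai) (negative-occ≤2 i))
      ... | yes (j₁ , c₁ , r₁) | no none₂ =
        firstNegPlan j₁ c₁ (negative c₁) r₁ ,
        single-rank (λ c → [ id , (λ r → contradiction (_ , c , r) none₂) ] (rank c))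
      ... | no none₁ | yes (j₂ , c₂ , r₂) =
        secondNegPlan j₂ c₂ (negative c₂) r₂ ,
        single-rank (λ c → [ (λ r → contradiction (_ , c , r) none₁) , id ] (rank c))
      ... | no none₁ | no none₂ =
        nonePlan ,
        ≤-reflexive (uncredited λ j c → [ (λ r → none₁ (j , c , r)) , (λ r → none₂ (j , c , r)) ] (rank c))

    -- A true variable is credited at most with the one clause containing x_i.
    planFor : (i : Fin n) → Σ (Plan i) λ P → credits i ≤ Plan.bonus P
    planFor i with a i in ai | Fin.any? (λ j → credited j ≟M just i)
    ... | _     | no none     = nonePlan , ≤-reflexive (uncredited λ j c → none (j , c))
    ... | true  | yes (j , c) =
      positivePlan j c (subst (λ b → (i , b) ∈ lookup φ j) ai (credited-sound c)) ,
      ≤-trans (credits≤occ i) (≤-reflexive (trans (cong (λ b → occ φ (i , b)) ai) (proj₁ (proj₂ wf i))))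
    ... | false | yes _       = Negative.plan ai

    greedy-bound : 0 < n → Σ _ λ M → IsGreedyMatching _≟V_ (graphG φ) M × 14 * n + numSat φ a ≤ weight M
    greedy-bound 0<n =
      let M , greedy , heavier = greedy-matching 0<n in
      M , greedy , ≤-trans (+-monoʳ-≤ (14 * n) credits≤bonus) heavier
      where
      open Assembly (proj₁ ∘ planFor)
      credits≤bonus : numSat φ a ≤ sum (map (Plan.bonus ∘ proj₁ ∘ planFor) (allFin n))
      credits≤bonus = ≤-trans satisfied≤credits (sum-map-mono (proj₂ ∘ planFor) (allFin n))

-- Without variables there are no edges and no satisfied clauses; otherwise the
-- construction above applies.
lemma1 : ∀ {n m} (φ : Formula n m) → WellFormed φ →
         ∀ (k : ℕ) (a : Assignment n) → k ≤ numSat φ a →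
         Σ (List (WEdge (Vtx n m))) λ M →
           IsGreedyMatching _≟V_ (graphG φ) M × 14 * n + k ≤ weight M
lemma1 {zero} φ wf k a k≤ = [] , Graph.empty-greedy φ refl , ≤-trans k≤ (Reduction.satisfied≤credits φ a)
lemma1 {suc _} φ wf k a k≤ =
  let M , greedy , heavier = Reduction.Counting.greedy-bound φ a wf (s≤s z≤n) in
  M , greedy , ≤-trans (+-monoʳ-≤ _ k≤) heavier
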